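{- Let $n,k$ be positive integers with $k\le n$, and let $c_k(n)$ denote the number of compositions of $n$ into $k$ parts, none of which equals $2$. Then $c_n(n)=1$, $c_{n-1}(n)=0$, and for $k<n-1$, \[c_k(n)=\sum_{i=1}^{\lfloor\frac{n-k}{2}\rfloor}\binom{k}{i}\binom{n-k-i-1}{i-1}.\]
   Context: A composition of $n$ into $k$ parts is an ordered $k$-tuple of positive integers summing to $n$. -}

module Defs where

open import Data.Nat using (ℕ; zero; suc; _+_; _∸_; _/_; _≟_)
open import Data.Nat.Combinatorics using (_C_)
open import Data.List using (List; []; _∷_; map; concatMap; filter; length; upTo)
open import Data.Nat.ListAction using (sum)
open import Data.Product using (_×_)
open import Relation.Nullary using (Dec)
open import Data.List.Relation.Unary.All using (All)
open import Data.List.Relation.Unary.All as All using (all?)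
open import Relation.Nullary using (¬_; ¬?; _×-dec_)
open import Relation.Binary.PropositionalEquality using (_≡_)

tuples : ℕ → ℕ → List (List ℕ)
tuples n zero    = [] ∷ []
tuples n (suc k) = concatMap (λ a → map (a ∷_) (tuples n k)) (map suc (upTo n))

-- A composition of n into k parts, none equal to 2:
-- a k-tuple of positive integers summing to n with no entry equal to 2.
-- (Every part of a composition of n is ≤ n, so enumerating entries in {1..n} is exhaustive.)
NoTwo : List ℕ → Set
NoTwo xs = All (λ x → ¬ (x ≡ 2)) xs

IsGoodComposition : ℕ → List ℕ → Set
IsGoodComposition n xs = sum xs ≡ n × NoTwo xs

isGoodComposition? : (n : ℕ) (xs : List ℕ) → Dec (IsGoodComposition n xs)
isGoodComposition? n xs = (sum xs ≟ n) ×-dec all? (λ x → ¬? (x ≟ 2)) xs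

c : ℕ → ℕ → ℕ
c k n = length (filter (isGoodComposition? n) (tuples n k))

sumFrom1 : ℕ → (ℕ → ℕ) → ℕ
sumFrom1 zero    f = 0
sumFrom1 (suc m) f = sumFrom1 m f + f (suc m)

-- Subtracting 1 from every part turns a composition of k + s into k parts, none equal to 2,
-- into a k-tuple of parts in {0} ∪ {2, 3, …} summing to s.  Choosing which i of the k
-- positions are nonzero gives c_k(k + s) = Σᵢ C(k, i) wᵢ(s), where wᵢ(s) counts compositions
-- of s into i parts ≥ 2; it vanishes for 2i > s, and otherwise stars and bars gives
-- wᵢ(s) = C(s − i − 1, i − 1).  Both counts are iterated convolutions, and the binomial
-- expansion follows from Pascal's rule.
module Submission where

open import Defs
open import Data.Bool using (true; false)
open import Data.Empty using (⊥-elim)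
open import Data.List using (List; []; _∷_; _++_; map; filter; length; concatMap; applyUpTo; upTo)
open import Data.List.Properties using (filter-++; length-++; filter-≐; filter-none; map-∘)
open import Data.List.Relation.Unary.All using (_∷_; universal)
open import Data.Nat using (ℕ; NonZero; zero; suc; _+_; _*_; _∸_; _≤_; _<_; _/_; z≤n; s≤s; _<?_; _≟_)
open import Data.Nat.Combinatorics using (_C_; k>n⇒nCk≡0; nCk+nC[k+1]≡[n+1]C[k+1]; nCn≡1)
open import Data.Nat.DivMod using (m/n*n≤m; m*n/n≡m; /-monoˡ-≤)
open import Data.Nat.ListAction using (sum)
open import Data.Nat.Properties
open import Data.Product using (_×_; _,_)
open import Function using (_∘_)
open import Relation.Binary.PropositionalEquality
  using (_≡_; _≢_; refl; sym; trans; cong; cong₂; subst; module ≡-Reasoning)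
open import Relation.Nullary using (¬_; yes; no; does)
open import Relation.Unary using (Pred; Decidable; _≐_)
open import Algebra.Properties.CommutativeSemigroup +-commutativeSemigroup
  using () renaming (interchange to +-interchange)
open import Algebra.Properties.CommutativeSemigroup *-commutativeSemigroup
  using () renaming (x∙yz≈y∙xz to *-left-comm)

sumBelow : ℕ → (ℕ → ℕ) → ℕ
sumBelow zero    f = 0
sumBelow (suc m) f = f 0 + sumBelow m (f ∘ suc)

sumBelow-cong : ∀ m {f h : ℕ → ℕ} → (∀ x → x < m → f x ≡ h x) → sumBelow m f ≡ sumBelow m h
sumBelow-cong zero    eq = refl
sumBelow-cong (suc m) eq = cong₂ _+_ (eq 0 (s≤s z≤n)) (sumBelow-cong m (λ x x<m → eq (suc x) (s≤s x<m)))

sumBelow-zero : ∀ m {f : ℕ → ℕ} → (∀ x → x < m → f x ≡ 0) → sumBelow m f ≡ 0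
sumBelow-zero zero    eq = refl
sumBelow-zero (suc m) eq = cong₂ _+_ (eq 0 (s≤s z≤n)) (sumBelow-zero m (λ x x<m → eq (suc x) (s≤s x<m)))

sumBelow-extend : ∀ {m N} (f : ℕ → ℕ) → m ≤ N → (∀ x → m ≤ x → x < N → f x ≡ 0) →
                  sumBelow N f ≡ sumBelow m f
sumBelow-extend {zero}  {N}     f _         eq = sumBelow-zero N (λ x x<N → eq x z≤n x<N)
sumBelow-extend {suc m} {suc N} f (s≤s m≤N) eq =
  cong (f 0 +_) (sumBelow-extend (f ∘ suc) m≤N (λ x m≤x x<N → eq (suc x) (s≤s m≤x) (s≤s x<N)))

sumBelow-suc : ∀ m (f : ℕ → ℕ) → sumBelow (suc m) f ≡ sumBelow m f + f m
sumBelow-suc zero    f = +-comm (f 0) 0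
sumBelow-suc (suc m) f = trans (cong (f 0 +_) (sumBelow-suc m (f ∘ suc))) (sym (+-assoc (f 0) _ _))

sumBelow-+ : ∀ m (f h : ℕ → ℕ) → sumBelow m (λ x → f x + h x) ≡ sumBelow m f + sumBelow m h
sumBelow-+ zero    f h = refl
sumBelow-+ (suc m) f h =
  trans (cong (f 0 + h 0 +_) (sumBelow-+ m (f ∘ suc) (h ∘ suc))) (+-interchange (f 0) (h 0) _ _)

*-distribˡ-sumBelow : ∀ m a (f : ℕ → ℕ) → a * sumBelow m f ≡ sumBelow m (λ x → a * f x)
*-distribˡ-sumBelow zero    a f = *-zeroʳ a
*-distribˡ-sumBelow (suc m) a f = trans (*-distribˡ-+ a (f 0) _) (cong (a * f 0 +_) (*-distribˡ-sumBelow m a (f ∘ suc)))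

sumBelow-comm : ∀ m K (h : ℕ → ℕ → ℕ) →
                sumBelow m (λ x → sumBelow K (λ i → h i x)) ≡ sumBelow K (λ i → sumBelow m (h i))
sumBelow-comm m zero    h = sumBelow-zero m (λ _ _ → refl)
sumBelow-comm m (suc K) h =
  trans (sumBelow-+ m (h 0) (λ x → sumBelow K (λ i → h (suc i) x)))
        (cong (sumBelow m (h 0) +_) (sumBelow-comm m K (h ∘ suc)))

sumFrom1≡sumBelow : ∀ m (f : ℕ → ℕ) → sumFrom1 m f ≡ sumBelow m (f ∘ suc)
sumFrom1≡sumBelow zero    f = refl
sumFrom1≡sumBelow (suc m) f = trans (cong (_+ f (suc m)) (sumFrom1≡sumBelow m f)) (sym (sumBelow-suc m (f ∘ suc)))

module _ {a b p} {A : Set a} {B : Set b} {P : Pred A p} (P? : Decidable P) where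

  length-filter-map : ∀ (f : B → A) xs → length (filter P? (map f xs)) ≡ length (filter (P? ∘ f) xs)
  length-filter-map f []       = refl
  length-filter-map f (x ∷ xs) with does (P? (f x))
  ... | true  = cong suc (length-filter-map f xs)
  ... | false = length-filter-map f xs

  length-filter-concatMap : ∀ (f : B → List A) xs →
                            length (filter P? (concatMap f xs)) ≡ sum (map (length ∘ filter P? ∘ f) xs)
  length-filter-concatMap f []       = refl
  length-filter-concatMap f (x ∷ xs) = begin
    length (filter P? (f x ++ concatMap f xs))                  ≡⟨ cong length (filter-++ P? (f x) (concatMap f xs)) ⟩
    length (filter P? (f x) ++ filter P? (concatMap f xs))      ≡⟨ length-++ (filter P? (f x)) ⟩
    length (filter P? (f x)) + length (filter P? (concatMap f xs))
      ≡⟨ cong (length (filter P? (f x)) +_) (length-filter-concatMap f xs) ⟩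
    sum (map (length ∘ filter P? ∘ f) (x ∷ xs))                 ∎
    where open ≡-Reasoning

length-filter-none : ∀ {a p} {A : Set a} {P : Pred A p} (P? : Decidable P) → (∀ x → ¬ P x) →
                     ∀ xs → length (filter P? xs) ≡ 0
length-filter-none P? ¬P xs = cong length (filter-none P? (universal ¬P xs))

sum-map-applyUpTo : ∀ (f g : ℕ → ℕ) N → sum (map f (applyUpTo g N)) ≡ sumBelow N (f ∘ g)
sum-map-applyUpTo f g zero    = refl
sum-map-applyUpTo f g (suc N) = cong (f (g 0) +_) (sum-map-applyUpTo f (g ∘ suc) N)

binomialSum : ℕ → (ℕ → ℕ) → ℕ
binomialSum k f = sumBelow (suc k) (λ i → (k C i) * f i)

binomialSum-pascal : ∀ k f → binomialSum (suc k) f ≡ binomialSum k f + binomialSum k (f ∘ suc)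
binomialSum-pascal k f = begin
  1 * f 0 + sumBelow (suc k) (λ i → (suc k C suc i) * f (suc i))
    ≡⟨ cong (1 * f 0 +_) (sumBelow-cong (suc k) (λ i _ → pascal i)) ⟩
  1 * f 0 + sumBelow (suc k) (λ i → (k C i) * f (suc i) + (k C suc i) * f (suc i))
    ≡⟨ cong (1 * f 0 +_) (sumBelow-+ (suc k) (λ i → (k C i) * f (suc i)) (λ i → (k C suc i) * f (suc i))) ⟩
  1 * f 0 + (binomialSum k (f ∘ suc) + sumBelow (suc k) (λ i → (k C suc i) * f (suc i)))
    ≡⟨ cong (λ t → 1 * f 0 + (binomialSum k (f ∘ suc) + t)) (sumBelow-suc k _) ⟩
  1 * f 0 + (binomialSum k (f ∘ suc) + (rest + (k C suc k) * f (suc k)))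
    ≡⟨ cong (λ t → 1 * f 0 + (binomialSum k (f ∘ suc) + (rest + t * f (suc k)))) (k>n⇒nCk≡0 (n<1+n k)) ⟩
  1 * f 0 + (binomialSum k (f ∘ suc) + (rest + 0))
    ≡⟨ cong (λ t → 1 * f 0 + t) (trans (cong (binomialSum k (f ∘ suc) +_) (+-identityʳ rest))
                                       (+-comm (binomialSum k (f ∘ suc)) rest)) ⟩
  1 * f 0 + (rest + binomialSum k (f ∘ suc))
    ≡⟨ sym (+-assoc (1 * f 0) rest _) ⟩
  binomialSum k f + binomialSum k (f ∘ suc) ∎
  where
  open ≡-Reasoning
  rest : ℕ
  rest = sumBelow k (λ i → (k C suc i) * f (suc i))
  pascal : ∀ i → (suc k C suc i) * f (suc i) ≡ (k C i) * f (suc i) + (k C suc i) * f (suc i)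
  pascal i = trans (cong (_* f (suc i)) (sym (nCk+nC[k+1]≡[n+1]C[k+1] k i))) (*-distribʳ-+ (f (suc i)) (k C i) (k C suc i))

binomialSum-head : ∀ k (f : ℕ → ℕ) → (∀ i → f (suc i) ≡ 0) → binomialSum k f ≡ f 0
binomialSum-head k f f∘suc≡0 =
  trans (cong₂ _+_ (*-identityˡ (f 0)) (sumBelow-zero k (λ i _ → trans (cong ((k C suc i) *_) (f∘suc≡0 i)) (*-zeroʳ (k C suc i)))))
        (+-identityʳ (f 0))

convolve : (ℕ → ℕ) → (ℕ → ℕ) → ℕ → ℕ
convolve w F m = sumBelow m (λ x → w (suc x) * F (m ∸ suc x))

convolve-congʷ : ∀ w v (F : ℕ → ℕ) → (∀ x → w (suc x) ≡ v (suc x)) → ∀ m → convolve w F m ≡ convolve v F m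
convolve-congʷ w v F w≗v m = sumBelow-cong m (λ x _ → cong (_* _) (w≗v x))

convolve-congᶠ : ∀ w {F G : ℕ → ℕ} → (∀ t → F t ≡ G t) → ∀ m → convolve w F m ≡ convolve w G m
convolve-congᶠ w F≗G m = sumBelow-cong m (λ x _ → cong (w (suc x) *_) (F≗G (m ∸ suc x)))

convolve-shift : ∀ w {F : ℕ → ℕ} k → (∀ t → t < k → F t ≡ 0) →
                 ∀ s → convolve w F (k + s) ≡ convolve w (F ∘ (k +_)) s
convolve-shift w {F} k F<k≡0 s =
  trans (sumBelow-extend _ (m≤n+m s k) (λ x s≤x x<k+s → trans (cong (w (suc x) *_) (F<k≡0 _ (rest<k s≤x x<k+s)))
                                                             (*-zeroʳ (w (suc x)))))
        (sumBelow-cong s (λ x x<s → cong (λ t → w (suc x) * F t) (+-∸-assoc k x<s)))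
  where
  rest<k : ∀ {x} → s ≤ x → x < k + s → k + s ∸ suc x < k
  rest<k {x} s≤x x<k+s = +-cancelʳ-< (suc x) (k + s ∸ suc x) k (begin-strict
    k + s ∸ suc x + suc x ≡⟨ m∸n+n≡m x<k+s ⟩
    k + s                 <⟨ +-monoʳ-< k (s≤s s≤x) ⟩
    k + suc x             ∎)
    where open ≤-Reasoning

convolve-linear : ∀ w K (a : ℕ → ℕ) (h : ℕ → ℕ → ℕ) s →
                  convolve w (λ t → sumBelow K (λ i → a i * h i t)) s ≡ sumBelow K (λ i → a i * convolve w (h i) s)
convolve-linear w K a h s = begin
  sumBelow s (λ x → w (suc x) * sumBelow K (λ i → a i * h i (s ∸ suc x)))
    ≡⟨ sumBelow-cong s (λ x _ → trans (*-distribˡ-sumBelow K (w (suc x)) _)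
                                      (sumBelow-cong K (λ i _ → *-left-comm (w (suc x)) (a i) _))) ⟩
  sumBelow s (λ x → sumBelow K (λ i → a i * (w (suc x) * h i (s ∸ suc x))))
    ≡⟨ sumBelow-comm s K _ ⟩
  sumBelow K (λ i → sumBelow s (λ x → a i * (w (suc x) * h i (s ∸ suc x))))
    ≡⟨ sumBelow-cong K (λ i _ → sym (*-distribˡ-sumBelow s (a i) _)) ⟩
  sumBelow K (λ i → a i * convolve w (h i) s) ∎
  where open ≡-Reasoning

-- The number of compositions of m into k parts, each counted with the product of the weights w of its parts.
compositions : (ℕ → ℕ) → ℕ → ℕ → ℕ
compositions w zero    zero    = 1
compositions w zero    (suc _) = 0
compositions w (suc k) m       = convolve w (compositions w k) m

compositions-vanish : ∀ w b → (∀ x → suc x < b → w (suc x) ≡ 0) →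
                      ∀ k s → s < k * b → compositions w k s ≡ 0
compositions-vanish w b small≡0 (suc k) s s<[1+k]b = sumBelow-zero s term≡0
  where
  term≡0 : ∀ x → x < s → w (suc x) * compositions w k (s ∸ suc x) ≡ 0
  term≡0 x x<s with suc x <? b
  ... | yes x<b = cong (_* compositions w k (s ∸ suc x)) (small≡0 x x<b)
  ... | no  x≮b = trans (cong (w (suc x) *_) (compositions-vanish w b small≡0 k (s ∸ suc x) rest<kb))
                        (*-zeroʳ (w (suc x)))
    where
    rest<kb : s ∸ suc x < k * b
    rest<kb = +-cancelˡ-< (suc x) (s ∸ suc x) (k * b) (begin-strict
      suc x + (s ∸ suc x) ≡⟨ m+[n∸m]≡n x<s ⟩
      s                   <⟨ s<[1+k]b ⟩
      b + k * b           ≤⟨ +-monoˡ-≤ (k * b) (≮⇒≥ x≮b) ⟩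
      suc x + k * b       ∎)
      where open ≤-Reasoning

isNotTwo : ℕ → ℕ
isNotTwo 2 = 0
isNotTwo _ = 1

isNotTwo-≢2 : ∀ {a} → a ≢ 2 → isNotTwo a ≡ 1
isNotTwo-≢2 {0}                   _   = refl
isNotTwo-≢2 {1}                   _   = refl
isNotTwo-≢2 {2}                   a≢2 = ⊥-elim (a≢2 refl)
isNotTwo-≢2 {suc (suc (suc _))}   _   = refl

isGoodComposition-∷ : ∀ {m a} → a ≤ m → a ≢ 2 →
                      (λ xs → IsGoodComposition m (a ∷ xs)) ≐ IsGoodComposition (m ∸ a)
isGoodComposition-∷ {m} {a} a≤m a≢2 =
  (λ { {xs} (sum≡m , _ ∷ noTwo) → trans (sym (m+n∸m≡n a (sum xs))) (cong (_∸ a) sum≡m) , noTwo }) ,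
  (λ { (sum≡m∸a , noTwo) → trans (cong (a +_) sum≡m∸a) (m+[n∸m]≡n a≤m) , a≢2 ∷ noTwo })

countGood : ℕ → ℕ → ℕ → ℕ
countGood N k m = length (filter (isGoodComposition? m) (tuples N k))

length-filter-isGood-∷ : ∀ {m a} xs → a ≤ m →
  length (filter (isGoodComposition? m) (map (a ∷_) xs)) ≡ isNotTwo a * length (filter (isGoodComposition? (m ∸ a)) xs)
length-filter-isGood-∷ {m} {a} xs a≤m with a ≟ 2
... | yes refl = trans (length-filter-map (isGoodComposition? m) (2 ∷_) xs)
                       (length-filter-none _ (λ { _ (_ , 2≢2 ∷ _) → 2≢2 refl }) xs)
... | no  a≢2  = begin
  length (filter (isGoodComposition? m) (map (a ∷_) xs))
    ≡⟨ length-filter-map (isGoodComposition? m) (a ∷_) xs ⟩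
  length (filter (isGoodComposition? m ∘ (a ∷_)) xs)
    ≡⟨ cong length (filter-≐ _ (isGoodComposition? (m ∸ a)) (isGoodComposition-∷ a≤m a≢2) xs) ⟩
  length (filter (isGoodComposition? (m ∸ a)) xs)
    ≡⟨ *-identityˡ _ ⟨
  1 * length (filter (isGoodComposition? (m ∸ a)) xs)
    ≡⟨ cong (_* length (filter (isGoodComposition? (m ∸ a)) xs)) (isNotTwo-≢2 a≢2) ⟨
  isNotTwo a * length (filter (isGoodComposition? (m ∸ a)) xs) ∎
  where open ≡-Reasoning

length-filter-isGood-∷-tooLarge : ∀ {m a} xs → m < a → length (filter (isGoodComposition? m) (map (a ∷_) xs)) ≡ 0
length-filter-isGood-∷-tooLarge {m} {a} xs m<a =
  trans (length-filter-map (isGoodComposition? m) (a ∷_) xs)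
        (length-filter-none _ (λ ys (sum≡m , _) → <⇒≱ m<a (subst (a ≤_) sum≡m (m≤m+n a (sum ys)))) xs)

countGood≡compositions : ∀ k {N m} → m ≤ N → countGood N k m ≡ compositions isNotTwo k m
countGood≡compositions zero    {m = zero}  _   = refl
countGood≡compositions zero    {m = suc m} _   = refl
countGood≡compositions (suc k) {N} {m} m≤N = begin
  length (filter (isGoodComposition? m) (concatMap prepend (map suc (upTo N))))
    ≡⟨ length-filter-concatMap (isGoodComposition? m) prepend (map suc (upTo N)) ⟩
  sum (map firstPart (map suc (upTo N)))
    ≡⟨ cong sum (map-∘ (upTo N)) ⟨
  sum (map (firstPart ∘ suc) (upTo N))
    ≡⟨ sum-map-applyUpTo (firstPart ∘ suc) (λ x → x) N ⟩
  sumBelow N (firstPart ∘ suc)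
    ≡⟨ sumBelow-extend (firstPart ∘ suc) m≤N (λ x m≤x _ → length-filter-isGood-∷-tooLarge (tuples N k) (s≤s m≤x)) ⟩
  sumBelow m (firstPart ∘ suc)
    ≡⟨ sumBelow-cong m (λ x x<m → trans (length-filter-isGood-∷ (tuples N k) x<m)
                                        (cong (isNotTwo (suc x) *_) (countGood≡compositions k (≤-trans (m∸n≤m m (suc x)) m≤N)))) ⟩
  compositions isNotTwo (suc k) m ∎
  where
  open ≡-Reasoning
  prepend : ℕ → List (List ℕ)
  prepend a = map (a ∷_) (tuples N k)
  firstPart : ℕ → ℕ
  firstPart = length ∘ filter (isGoodComposition? m) ∘ prepend

isAtLeastTwo : ℕ → ℕ
isAtLeastTwo 0             = 0
isAtLeastTwo 1             = 0
isAtLeastTwo (suc (suc _)) = 1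

isNotTwo∘suc≗isAtLeastTwo : ∀ x → isNotTwo (suc (suc x)) ≡ isAtLeastTwo (suc x)
isNotTwo∘suc≗isAtLeastTwo zero    = refl
isNotTwo∘suc≗isAtLeastTwo (suc x) = refl

compositions-isNotTwo-< : ∀ k t → t < k → compositions isNotTwo k t ≡ 0
compositions-isNotTwo-< k t t<k =
  compositions-vanish isNotTwo 1 (λ { _ (s≤s ()) }) k t (subst (t <_) (sym (*-identityʳ k)) t<k)

-- Lowering every part by 1, a first part 1 disappears and a first part a ≥ 3 becomes a part a − 1 ≥ 2.
compositions-isNotTwo-suc : ∀ k s →
  compositions isNotTwo (suc k) (suc k + s) ≡
  compositions isNotTwo k (k + s) + convolve isAtLeastTwo (λ t → compositions isNotTwo k (k + t)) s
compositions-isNotTwo-suc k s =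
  cong₂ _+_ (*-identityˡ _)
            (trans (convolve-congʷ (isNotTwo ∘ suc) isAtLeastTwo (compositions isNotTwo k) isNotTwo∘suc≗isAtLeastTwo (k + s))
                   (convolve-shift isAtLeastTwo k (compositions-isNotTwo-< k) s))

compositions-isNotTwo-+ : ∀ k s →
  compositions isNotTwo k (k + s) ≡ binomialSum k (λ i → compositions isAtLeastTwo i s)
compositions-isNotTwo-+ zero    zero    = refl
compositions-isNotTwo-+ zero    (suc s) = refl
compositions-isNotTwo-+ (suc k) s       = begin
  N (suc k) (suc k + s)
    ≡⟨ compositions-isNotTwo-suc k s ⟩
  N k (k + s) + convolve isAtLeastTwo (λ t → N k (k + t)) s
    ≡⟨ cong₂ _+_ (compositions-isNotTwo-+ k s) (convolve-congᶠ isAtLeastTwo (compositions-isNotTwo-+ k) s) ⟩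
  binomialSum k (λ i → W i s) + convolve isAtLeastTwo (λ t → binomialSum k (λ i → W i t)) s
    ≡⟨ cong (binomialSum k (λ i → W i s) +_) (convolve-linear isAtLeastTwo (suc k) (k C_) W s) ⟩
  binomialSum k (λ i → W i s) + binomialSum k (λ i → W (suc i) s)
    ≡⟨ binomialSum-pascal k (λ i → W i s) ⟨
  binomialSum (suc k) (λ i → W i s) ∎
  where
  open ≡-Reasoning
  N = compositions isNotTwo
  W = compositions isAtLeastTwo

compositions-isAtLeastTwo-< : ∀ i s → s < i * 2 → compositions isAtLeastTwo i s ≡ 0
compositions-isAtLeastTwo-< = compositions-vanish isAtLeastTwo 2 small≡0
  where
  small≡0 : ∀ x → suc x < 2 → isAtLeastTwo (suc x) ≡ 0
  small≡0 zero    _                 = refl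
  small≡0 (suc x) (s≤s (s≤s ()))

-- A composition of 2 + s into parts ≥ 2 either starts with 2, or its first part can be lowered by 1.
compositions-isAtLeastTwo-suc : ∀ i s →
  compositions isAtLeastTwo (suc i) (2 + s) ≡ compositions isAtLeastTwo i s + compositions isAtLeastTwo (suc i) (suc s)
compositions-isAtLeastTwo-suc i s = cong (_+ convolve (isAtLeastTwo ∘ suc) (compositions isAtLeastTwo i) s)
                                         (*-identityˡ (compositions isAtLeastTwo i s))

compositions-isAtLeastTwo-closed : ∀ j e → compositions isAtLeastTwo (suc j) (suc j * 2 + e) ≡ (j + e) C j
compositions-isAtLeastTwo-closed zero    zero    = refl
compositions-isAtLeastTwo-closed zero    (suc e) =
  trans (compositions-isAtLeastTwo-suc 0 (suc e)) (compositions-isAtLeastTwo-closed zero e)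
compositions-isAtLeastTwo-closed (suc j) zero    = begin
  W (2 + j) (2 + (suc j * 2 + 0))
    ≡⟨ compositions-isAtLeastTwo-suc (suc j) (suc j * 2 + 0) ⟩
  W (suc j) (suc j * 2 + 0) + W (2 + j) (suc (suc j * 2 + 0))
    ≡⟨ cong₂ _+_ (compositions-isAtLeastTwo-closed j 0)
                 (compositions-isAtLeastTwo-< (2 + j) _ (s≤s (s≤s (≤-reflexive (+-identityʳ _))))) ⟩
  (j + 0) C j + 0
    ≡⟨ trans (+-identityʳ _) (trans (cong (_C j) (+-identityʳ j)) (nCn≡1 j)) ⟩
  1
    ≡⟨ sym (trans (cong (_C suc j) (+-identityʳ (suc j))) (nCn≡1 (suc j))) ⟩
  (suc j + 0) C suc j ∎
  where
  open ≡-Reasoning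
  W = compositions isAtLeastTwo
compositions-isAtLeastTwo-closed (suc j) (suc e) = begin
  W (2 + j) (2 + (suc j * 2 + suc e))
    ≡⟨ compositions-isAtLeastTwo-suc (suc j) (suc j * 2 + suc e) ⟩
  W (suc j) (suc j * 2 + suc e) + W (2 + j) (suc (suc j * 2 + suc e))
    ≡⟨ cong₂ _+_ (compositions-isAtLeastTwo-closed j (suc e))
                 (trans (cong (λ t → W (2 + j) (suc t)) (+-suc (suc j * 2) e)) (compositions-isAtLeastTwo-closed (suc j) e)) ⟩
  (j + suc e) C j + (suc j + e) C suc j
    ≡⟨ cong (λ t → (j + suc e) C j + t C suc j) (sym (+-suc j e)) ⟩
  (j + suc e) C j + (j + suc e) C suc j
    ≡⟨ nCk+nC[k+1]≡[n+1]C[k+1] (j + suc e) j ⟩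
  (suc j + suc e) C suc j ∎
  where
  open ≡-Reasoning
  W = compositions isAtLeastTwo

compositions-isAtLeastTwo-binomial : ∀ j s → suc j * 2 ≤ s → compositions isAtLeastTwo (suc j) s ≡ (s ∸ suc j ∸ 1) C j
compositions-isAtLeastTwo-binomial j s 2[1+j]≤s =
  subst (λ t → compositions isAtLeastTwo (suc j) t ≡ (t ∸ suc j ∸ 1) C j) (m+[n∸m]≡n 2[1+j]≤s)
        (trans (compositions-isAtLeastTwo-closed j e) (cong (_C j) (sym excess)))
  where
  e = s ∸ suc j * 2
  excess : suc j * 2 + e ∸ suc j ∸ 1 ≡ j + e
  excess = trans (cong (λ t → t ∸ suc j ∸ 1) split) (cong (_∸ 1) (m+n∸m≡n (suc j) (suc (j + e))))
    where
    split : suc j * 2 + e ≡ suc j + suc (j + e)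
    split = cong suc (begin
      suc (j * 2 + e)        ≡⟨ cong (λ t → suc (t + e)) (*-comm j 2) ⟩
      suc (j + (j + 0) + e)  ≡⟨ cong (λ t → suc (j + t + e)) (+-identityʳ j) ⟩
      suc (j + j + e)        ≡⟨ cong suc (+-assoc j j e) ⟩
      suc (j + (j + e))      ≡⟨ +-suc j (j + e) ⟨
      j + suc (j + e)        ∎)
      where open ≡-Reasoning

c-+ : ∀ k s → c k (k + s) ≡ binomialSum k (λ i → compositions isAtLeastTwo i s)
c-+ k s = trans (countGood≡compositions k ≤-refl) (compositions-isNotTwo-+ k s)

m≤n/o⇒m*o≤n : ∀ {m} n o .{{_ : NonZero o}} → m ≤ n / o → m * o ≤ n
m≤n/o⇒m*o≤n n o m≤n/o = ≤-trans (*-monoˡ-≤ o m≤n/o) (m/n*n≤m n o)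

n/o<m⇒n<m*o : ∀ {m} n o .{{_ : NonZero o}} → n / o < m → n < m * o
n/o<m⇒n<m*o {m} n o n/o<m = ≰⇒> (λ m*o≤n → <⇒≱ n/o<m (subst (_≤ n / o) (m*n/n≡m m o) (/-monoˡ-≤ o m*o≤n)))

binomialSum-closedForm : ∀ k {s} → 1 ≤ s →
  binomialSum k (λ i → compositions isAtLeastTwo i s) ≡ sumFrom1 (s / 2) (λ i → (k C i) * ((s ∸ i ∸ 1) C (i ∸ 1)))
binomialSum-closedForm k {s@(suc _)} _ = begin
  sumBelow k (term ∘ suc)
    ≡⟨ sumBelow-extend (term ∘ suc) (m≤m+n k (s / 2)) (λ x k≤x _ → cong (_* W (suc x) s) (k>n⇒nCk≡0 (s≤s k≤x))) ⟨
  sumBelow (k + s / 2) (term ∘ suc)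
    ≡⟨ sumBelow-extend (term ∘ suc) (m≤n+m (s / 2) k)
         (λ x s/2≤x _ → trans (cong ((k C suc x) *_) (compositions-isAtLeastTwo-< (suc x) s (n/o<m⇒n<m*o s 2 (s≤s s/2≤x))))
                              (*-zeroʳ (k C suc x))) ⟩
  sumBelow (s / 2) (term ∘ suc)
    ≡⟨ sumBelow-cong (s / 2) (λ x x<s/2 → cong ((k C suc x) *_) (compositions-isAtLeastTwo-binomial x s (m≤n/o⇒m*o≤n s 2 x<s/2))) ⟩
  sumBelow (s / 2) (λ x → (k C suc x) * ((s ∸ suc x ∸ 1) C x))
    ≡⟨ sumFrom1≡sumBelow (s / 2) (λ i → (k C i) * ((s ∸ i ∸ 1) C (i ∸ 1))) ⟨
  sumFrom1 (s / 2) (λ i → (k C i) * ((s ∸ i ∸ 1) C (i ∸ 1))) ∎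
  where
  open ≡-Reasoning
  W = compositions isAtLeastTwo
  term : ℕ → ℕ
  term i = (k C i) * W i s

c-closedForm : ∀ {k n} → k < n → c k n ≡ sumFrom1 ((n ∸ k) / 2) (λ i → (k C i) * ((n ∸ k ∸ i ∸ 1) C (i ∸ 1)))
c-closedForm {k} {n} k<n = begin
  c k n                                                       ≡⟨ cong (c k) (m+[n∸m]≡n (<⇒≤ k<n)) ⟨
  c k (k + (n ∸ k))                                           ≡⟨ c-+ k (n ∸ k) ⟩
  binomialSum k (λ i → compositions isAtLeastTwo i (n ∸ k))   ≡⟨ binomialSum-closedForm k (m<n⇒0<n∸m k<n) ⟩
  sumFrom1 ((n ∸ k) / 2) (λ i → (k C i) * ((n ∸ k ∸ i ∸ 1) C (i ∸ 1))) ∎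
  where open ≡-Reasoning

c-diagonal : ∀ n → c n n ≡ 1
c-diagonal n =
  trans (cong (c n) (sym (+-identityʳ n)))
        (trans (c-+ n 0) (binomialSum-head n (λ i → compositions isAtLeastTwo i 0) (λ _ → refl)))

c-subdiagonal : ∀ n → 1 ≤ n → c (n ∸ 1) n ≡ 0
c-subdiagonal (suc p) _ =
  trans (c-closedForm (n<1+n p)) (cong (λ s → sumFrom1 (s / 2) (λ i → (p C i) * ((s ∸ i ∸ 1) C (i ∸ 1)))) (m+n∸n≡m 1 p))

mainTheorem7 : (n k : ℕ) → 1 ≤ k → k ≤ n →
    (c n n ≡ 1) × (c (n ∸ 1) n ≡ 0)
      × (k < n ∸ 1 → c k n ≡ sumFrom1 ((n ∸ k) / 2) (λ i → (k C i) * ((n ∸ k ∸ i ∸ 1) C (i ∸ 1))))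
mainTheorem7 n k 1≤k k≤n =
  c-diagonal n , c-subdiagonal n (≤-trans 1≤k k≤n) , λ k<n∸1 → c-closedForm (<-≤-trans k<n∸1 (m∸n≤m n 1))
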